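{- Let $k$ be a positive integer and $S=\{6k+1,9k+2,9k+3\}$. Then the numerical semigroup $\langle S\rangle$ is a $3$-permutation numerical semigroup.
   Context: A numerical semigroup is a submonoid $G$ of $(\mathbb{N},+,0)$ with $\mathbb{N}\setminus G$ finite; $\langle S\rangle$ is the submonoid generated by $S$. Write the elements of $G$ as $0=g_0<g_1<g_2<\cdots$. For $n\ge 1$, $G$ is an $n$-permutation numerical semigroup if $G=\langle g_1,\dots,g_n\rangle$ and for every integer $k\ge 0$ the tuple $(g_{kn+1}\bmod n,\dots,g_{kn+n}\bmod n)$ contains exactly one representative of each residue class of $\mathbb{Z}/n\mathbb{Z}$. -}

module Defs where

open import Data.Nat using (ℕ; zero; suc; _+_; _*_; _<_; _≤_; NonZero)
open import Data.Nat.DivMod using (_%_)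
open import Data.Fin using (Fin; toℕ)
open import Data.Product using (Σ; ∃; ∃-syntax; ∃!; _×_; _,_)
open import Data.Sum using (_⊎_)
open import Relation.Binary.PropositionalEquality using (_≡_)

data ⟨_⟩ (S : ℕ → Set) : ℕ → Set where
  gen-zero : ⟨ S ⟩ 0
  gen-add  : ∀ {s x} → S s → ⟨ S ⟩ x → ⟨ S ⟩ (s + x)

record IsNumericalSemigroup (G : ℕ → Set) : Set where
  field
    has-zero : G 0
    closed   : ∀ {x y} → G x → G y → G (x + y)
    cofinite : ∃[ N ] (∀ m → N ≤ m → G m)

record IsIncreasingEnumeration (G : ℕ → Set) (g : ℕ → ℕ) : Set where
  field
    strictly-increasing : ∀ i → g i < g (suc i)
    in-G                : ∀ i → G (g i)
    exhaustive          : ∀ x → G x → ∃[ i ] g i ≡ x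

FirstGens : (n : ℕ) → (ℕ → ℕ) → ℕ → Set
FirstGens n g x = ∃[ i ] (Σ (Fin n) λ j → i ≡ suc (toℕ j) × x ≡ g i)

record IsPermutationNS (n : ℕ) .{{_ : NonZero n}} (G : ℕ → Set) : Set₁ where
  field
    numerical : IsNumericalSemigroup G
    g         : ℕ → ℕ
    enum      : IsIncreasingEnumeration G g
    generated : ∀ x → (G x → ⟨ FirstGens n g ⟩ x) × (⟨ FirstGens n g ⟩ x → G x)
    residues  : ∀ k (r : Fin n) →
                ∃! _≡_ (λ (j : Fin n) → g (k * n + suc (toℕ j)) % n ≡ toℕ r)

{-# OPTIONS --safe #-}
module Submission where

open import Defs
open import Data.Empty using (⊥-elim)
open import Data.Fin using (Fin; toℕ)
open import Data.Fin.Patterns using (0F; 1F; 2F)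
open import Data.List using (_∷_; [])
open import Data.Nat
open import Data.Nat.DivMod
open import Data.Nat.Properties
open import Data.Nat.Tactic.RingSolver using (solve)
open import Data.Product using (∃-syntax; ∃!; _×_; _,_)
open import Data.Sum using (_⊎_; inj₁; inj₂)
open import Data.Unit using (⊤; tt)
open import Function.Base using (_∋_)
open import Relation.Binary.Definitions using (tri<; tri≈; tri>)
open import Relation.Binary.PropositionalEquality
open import Relation.Nullary using (¬_; yes; no)

-- Write K = 3k, so the generators are 2K+1, 3K+2 and 3K+3, and x(2K+1) + y(3K+2) + z(3K+3)
-- = K L + u with L = 2x+3y+3z and u = x+2y+3z.  The elements of the semigroup are exactly
-- the numbers K L + u with L ≤ 2u and u + (2L mod 3) ≤ L.  For L ≤ 2K+1 these blocks are
-- intervals of consecutive integers lying in increasing order, and from K(2K+2) + K + 1 on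
-- every number is in the semigroup.  Since K ≡ 0 (mod 3), residues rise by one along a block
-- and from block 2j to block 2j+1; they jump by two only after an odd block, and the blocks
-- 2j and 2j+1 together hold a multiple of 3 elements, so each jump falls between two triples.

infix 4 _≡₃_

_≡₃_ : ℕ → ℕ → Set
m ≡₃ n = m % 3 ≡ n % 3

+-congˡ-≡₃ : ∀ o {m n} → m ≡₃ n → o + m ≡₃ o + n
+-congˡ-≡₃ o {m} {n} m≡n = begin
  (o + m) % 3          ≡⟨ %-distribˡ-+ o m 3 ⟩
  (o % 3 + m % 3) % 3  ≡⟨ cong (λ t → (o % 3 + t) % 3) m≡n ⟩
  (o % 3 + n % 3) % 3  ≡⟨ %-distribˡ-+ o n 3 ⟨
  (o + n) % 3          ∎
  where open ≡-Reasoning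

+-multiple-≡₃ : ∀ m q → m + q * 3 ≡₃ m
+-multiple-≡₃ m q = [m+kn]%n≡m%n m q 3

m+%n≡n⇒m≡[n/d]*d : ∀ {m n d} .{{_ : NonZero d}} → m + n % d ≡ n → m ≡ n / d * d
m+%n≡n⇒m≡[n/d]*d {m} {n} {d} eq = +-cancelʳ-≡ (n % d) m (n / d * d)
  (trans eq (trans (m≡m%n+[m/n]*n n d) (+-comm (n % d) (n / d * d))))

rotation-residues : ∀ c → c < 3 → ∀ (r : Fin 3) → ∃! _≡_ (λ (j : Fin 3) → (toℕ j + c) % 3 ≡ toℕ r)
rotation-residues 0 _ 0F = 0F , refl , λ { {0F} _ → refl ; {1F} () ; {2F} () }
rotation-residues 0 _ 1F = 1F , refl , λ { {0F} () ; {1F} _ → refl ; {2F} () }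
rotation-residues 0 _ 2F = 2F , refl , λ { {0F} () ; {1F} () ; {2F} _ → refl }
rotation-residues 1 _ 0F = 2F , refl , λ { {0F} () ; {1F} () ; {2F} _ → refl }
rotation-residues 1 _ 1F = 0F , refl , λ { {0F} _ → refl ; {1F} () ; {2F} () }
rotation-residues 1 _ 2F = 1F , refl , λ { {0F} () ; {1F} _ → refl ; {2F} () }
rotation-residues 2 _ 0F = 1F , refl , λ { {0F} () ; {1F} _ → refl ; {2F} () }
rotation-residues 2 _ 1F = 2F , refl , λ { {0F} () ; {1F} () ; {2F} _ → refl }
rotation-residues 2 _ 2F = 0F , refl , λ { {0F} _ → refl ; {1F} () ; {2F} () }
rotation-residues (suc (suc (suc _))) (s≤s (s≤s (s≤s ()))) _

consecutive-residues : (f : Fin 3 → ℕ) → f 1F ≡₃ 1 + f 0F → f 2F ≡₃ 1 + f 1F →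
                       ∀ r → ∃! _≡_ (λ (j : Fin 3) → f j % 3 ≡ toℕ r)
consecutive-residues f f₁ f₂ r with rotation-residues (f 0F % 3) (m%n<n (f 0F) 3) r
... | j , fj≡r , unique = j , trans (residue j) fj≡r , λ {i} fi≡r → unique (trans (sym (residue i)) fi≡r)
  where
  residue : ∀ j → f j % 3 ≡ (toℕ j + f 0F % 3) % 3
  residue 0F = sym (m%n%n≡m%n (f 0F) 3)
  residue 1F = trans f₁ (%-distribˡ-+ 1 (f 0F) 3)
  residue 2F = trans f₂ (trans (+-congˡ-≡₃ 1 {f 1F} {1 + f 0F} f₁) (%-distribˡ-+ 2 (f 0F) 3))

half-≤ : ∀ {h n} → h + h ≤ suc (n + n) → h ≤ n
half-≤ {zero} _ = z≤n
half-≤ {suc h} {zero} (s≤s le) with () ← subst (_≤ 0) (+-suc h h) le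
half-≤ {suc h} {suc n} (s≤s le) =
  s≤s (half-≤ (≤-pred (subst₂ _≤_ (+-suc h h) (cong suc (+-suc n n)) le)))

increasing-exhaustive : ∀ {P : ℕ → Set} (g : ℕ → ℕ) → g 0 ≡ 0 → (∀ i → g i < g (suc i)) →
                        (∀ i {w} → P w → g i < w → g (suc i) ≤ w) →
                        ∀ {x} → P x → ∃[ i ] g i ≡ x
increasing-exhaustive g g0≡0 increasing next {x} x∈ = search x 0 (subst (_≤ x) (sym g0≡0) z≤n) (m≤m+n x (g 0))
  where
  search : ∀ n i → g i ≤ x → x ≤ n + g i → ∃[ i′ ] g i′ ≡ x
  search n i gi≤x x≤ with g i ≟ x
  ... | yes gi≡x = i , gi≡x
  search zero    i gi≤x x≤ | no gi≢x = ⊥-elim (gi≢x (≤-antisym gi≤x x≤))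
  search (suc n) i gi≤x x≤ | no gi≢x = search n (suc i) (next i x∈ (≤∧≢⇒< gi≤x gi≢x))
    (≤-trans x≤ (≤-trans (≤-reflexive (sym (+-suc n (g i)))) (+-monoʳ-≤ n (increasing i))))

module _ {S : ℕ → Set} where

  ⟨⟩-+ : ∀ {x y} → ⟨ S ⟩ x → ⟨ S ⟩ y → ⟨ S ⟩ (x + y)
  ⟨⟩-+ gen-zero y∈ = y∈
  ⟨⟩-+ {y = y} (gen-add {s} {x} s∈ x∈) y∈ = subst ⟨ S ⟩ (sym (+-assoc s x y)) (gen-add s∈ (⟨⟩-+ x∈ y∈))

  ⟨⟩-*-+ : ∀ {s x} n → S s → ⟨ S ⟩ x → ⟨ S ⟩ (n * s + x)
  ⟨⟩-*-+ zero s∈ x∈ = x∈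
  ⟨⟩-*-+ {s} {x} (suc n) s∈ x∈ = subst ⟨ S ⟩ (sym (+-assoc s (n * s) x)) (gen-add s∈ (⟨⟩-*-+ n s∈ x∈))

  ⟨⟩-mono : ∀ {S′ : ℕ → Set} → (∀ {s} → S s → S′ s) → ∀ {x} → ⟨ S ⟩ x → ⟨ S′ ⟩ x
  ⟨⟩-mono S⊆S′ gen-zero = gen-zero
  ⟨⟩-mono S⊆S′ (gen-add s∈ x∈) = gen-add (S⊆S′ s∈) (⟨⟩-mono S⊆S′ x∈)

OneOf₃ : ℕ → ℕ → ℕ → ℕ → Set
OneOf₃ a b c x = x ≡ a ⊎ x ≡ b ⊎ x ≡ c

module _ {a b c : ℕ} where

  ⟨OneOf₃⟩⇒combination : ∀ {w} → ⟨ OneOf₃ a b c ⟩ w → ∃[ x ] ∃[ y ] ∃[ z ] w ≡ x * a + y * b + z * c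
  ⟨OneOf₃⟩⇒combination gen-zero = 0 , 0 , 0 , refl
  ⟨OneOf₃⟩⇒combination (gen-add (inj₁ refl) w∈) with x , y , z , refl ← ⟨OneOf₃⟩⇒combination w∈ =
    suc x , y , z , solve (a ∷ b ∷ c ∷ x ∷ y ∷ z ∷ [])
  ⟨OneOf₃⟩⇒combination (gen-add (inj₂ (inj₁ refl)) w∈) with x , y , z , refl ← ⟨OneOf₃⟩⇒combination w∈ =
    x , suc y , z , solve (a ∷ b ∷ c ∷ x ∷ y ∷ z ∷ [])
  ⟨OneOf₃⟩⇒combination (gen-add (inj₂ (inj₂ refl)) w∈) with x , y , z , refl ← ⟨OneOf₃⟩⇒combination w∈ =
    x , y , suc z , solve (a ∷ b ∷ c ∷ x ∷ y ∷ z ∷ [])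

  combination⇒⟨OneOf₃⟩ : ∀ x y z → ⟨ OneOf₃ a b c ⟩ (x * a + y * b + z * c)
  combination⇒⟨OneOf₃⟩ x y z = subst ⟨ OneOf₃ a b c ⟩ reassoc
    (⟨⟩-*-+ x (inj₁ refl) (⟨⟩-*-+ y (inj₂ (inj₁ refl)) (⟨⟩-*-+ z (inj₂ (inj₂ refl)) gen-zero)))
    where
    reassoc : x * a + (y * b + (z * c + 0)) ≡ x * a + y * b + z * c
    reassoc = solve (a ∷ b ∷ c ∷ x ∷ y ∷ z ∷ [])

-- In a representation 2x + 3y + 3z = L we have x ≡ 2L (mod 3), so minA L is the least
-- possible coefficient of the generator 2K+1.
minA : ℕ → ℕ
minA L = 2 * L % 3

minA≤2 : ∀ L → minA L ≤ 2
minA≤2 L = ≤-pred (m%n<n (2 * L) 3)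

minA-+3 : ∀ L → minA (3 + L) ≡ minA L
minA-+3 L = trans (cong (_% 3) rearrange) ([m+kn]%n≡m%n (2 * L) 2 3)
  where
  rearrange : 2 * (3 + L) ≡ 2 * L + 2 * 3
  rearrange = solve (L ∷ [])

minA-even : ∀ j → minA (2 * j) ≡ j % 3
minA-even j = trans (cong (_% 3) rearrange) ([m+kn]%n≡m%n j j 3)
  where
  rearrange : 2 * (2 * j) ≡ j + j * 3
  rearrange = solve (j ∷ [])

minA-odd : ∀ j → minA (suc (2 * j)) ≡ (2 + j) % 3
minA-odd j = trans (cong (_% 3) rearrange) ([m+kn]%n≡m%n (2 + j) j 3)
  where
  rearrange : 2 * suc (2 * j) ≡ 2 + j + j * 3
  rearrange = solve (j ∷ [])

minA-odd≤ : ∀ {j} → 1 ≤ j → minA (suc (2 * j)) ≤ j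
minA-odd≤ {suc zero}    _ = z≤n
minA-odd≤ {suc (suc j)} _ = ≤-trans (minA≤2 (suc (2 * suc (suc j)))) (s≤s (s≤s z≤n))

record Admissible (L u : ℕ) : Set where
  constructor admissible
  field
    L≤2u : L ≤ u + u
    fits : u + minA L ≤ L

decompose-without-c : ∀ {L d} → d + d ≤ L → L ≤ d + d + d → ∃[ x ] ∃[ y ] (2 * x + 3 * y ≡ L × x + y ≡ d)
decompose-without-c {d = d} 2d≤L L≤3d with m≤n⇒∃[o]m+o≡n 2d≤L
... | p , refl with m≤n⇒∃[o]m+o≡n (+-cancelˡ-≤ (d + d) p d L≤3d)
...   | q , refl = q , p , solve (p ∷ q ∷ []) , +-comm q p

room-for-c : ∀ L d → d + d + d < 3 + L → minA (3 + L) ≤ d → d + d ≤ L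
room-for-c L zero _ _ = z≤n
room-for-c zero (suc zero) (s≤s (s≤s (s≤s ()))) _
room-for-c (suc zero) (suc zero) _ (s≤s ())
room-for-c (suc (suc L)) (suc zero) _ _ = s≤s (s≤s z≤n)
room-for-c L (suc (suc d)) 3d<3+L _ = +-cancelˡ-≤ 2 _ _ (begin
  2 + (2 + d + (2 + d))     ≡⟨ +-comm 2 (2 + d + (2 + d)) ⟩
  2 + d + (2 + d) + 2       ≤⟨ +-monoʳ-≤ (2 + d + (2 + d)) (m≤m+n 2 d) ⟩
  2 + d + (2 + d) + (2 + d) ≤⟨ ≤-pred 3d<3+L ⟩
  2 + L                     ∎)
  where open ≤-Reasoning

decompose : ∀ L d → d + d ≤ L → minA L ≤ d → ∃[ x ] ∃[ y ] ∃[ z ] (2 * x + 3 * y + 3 * z ≡ L × x + y ≡ d)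
decompose L d 2d≤L minA≤d with L ≤? d + d + d
... | yes L≤3d with x , y , 2x+3y≡L , x+y≡d ← decompose-without-c 2d≤L L≤3d =
  x , y , 0 , trans (+-identityʳ _) 2x+3y≡L , x+y≡d
decompose (suc (suc (suc L))) d 2d≤L minA≤d | no L≰3d
  with x , y , z , 2x+3y+3z≡L , x+y≡d ←
         decompose L d (room-for-c L d (≰⇒> L≰3d) minA≤d) (subst (_≤ d) (minA-+3 L) minA≤d) =
  x , y , suc z , (begin
    2 * x + 3 * y + 3 * suc z    ≡⟨ solve (x ∷ y ∷ z ∷ []) ⟩
    3 + (2 * x + 3 * y + 3 * z)  ≡⟨ cong (3 +_) 2x+3y+3z≡L ⟩
    3 + L                        ∎) , x+y≡d
  where open ≡-Reasoning
decompose zero d _ _ | no L≰3d = ⊥-elim (L≰3d z≤n)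
decompose (suc zero) zero _ () | no _
decompose (suc zero) (suc d) _ _ | no L≰3d = ⊥-elim (L≰3d (s≤s z≤n))
decompose (suc (suc zero)) zero _ () | no _
decompose (suc (suc zero)) (suc d) _ _ | no L≰3d = ⊥-elim (L≰3d (s≤s (≤-trans (s≤s z≤n) (m≤n+m (suc d) (d + suc d)))))

decompose-admissible : ∀ {L u} → Admissible L u →
                       ∃[ x ] ∃[ y ] ∃[ z ] (2 * x + 3 * y + 3 * z ≡ L × x + 2 * y + 3 * z ≡ u)
decompose-admissible {u = u} (admissible L≤2u fits) with m≤n⇒∃[o]m+o≡n (≤-trans (m≤m+n u _) fits)
... | d , refl with decompose (u + d) d (+-monoˡ-≤ d (+-cancelˡ-≤ u _ _ L≤2u)) (+-cancelˡ-≤ u _ _ fits)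
...   | x , y , z , 2x+3y+3z≡L , refl = x , y , z , 2x+3y+3z≡L ,
  +-cancelʳ-≡ (x + y) _ u (begin
    x + 2 * y + 3 * z + (x + y)  ≡⟨ solve (x ∷ y ∷ z ∷ []) ⟩
    2 * x + 3 * y + 3 * z        ≡⟨ 2x+3y+3z≡L ⟩
    u + (x + y)                  ∎)
  where open ≡-Reasoning

lower-block-below : ∀ {K L′ u′ M u} → 2 ≤ K → L′ ≤ M → u′ ≤ L′ → u + minA (suc M) ≡ suc M →
                    K * L′ + u′ < K * suc M + u
lower-block-below {K} {L′} {u′} {M} {u} 2≤K L′≤M u′≤L′ top = +-cancelʳ-≤ 2 _ _ (begin
  suc (K * L′ + u′) + 2           ≤⟨ +-monoˡ-≤ 2 (s≤s (+-mono-≤ (*-monoʳ-≤ K L′≤M) (≤-trans u′≤L′ L′≤M))) ⟩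
  suc (K * M + M) + 2             ≡⟨ solve (K ∷ M ∷ []) ⟩
  K * M + M + (2 + 1)             ≤⟨ +-monoʳ-≤ (K * M + M) (+-monoˡ-≤ 1 2≤K) ⟩
  K * M + M + (K + 1)             ≡⟨ solve (K ∷ M ∷ []) ⟩
  K * suc M + suc M               ≡⟨ cong (K * suc M +_) top ⟨
  K * suc M + (u + minA (suc M))  ≡⟨ +-assoc (K * suc M) u _ ⟨
  K * suc M + u + minA (suc M)    ≤⟨ +-monoʳ-≤ (K * suc M + u) (minA≤2 (suc M)) ⟩
  K * suc M + u + 2               ∎)
  where open ≤-Reasoning

top-below-next-block : ∀ {K L u L′ u′} → 2 ≤ K → u + minA L ≡ L → Admissible L′ u′ →
                       K * L + u < K * L′ + u′ → L < L′
top-below-next-block {K} {L} {u} {L′} {u′} 2≤K top (admissible L′≤2u′ fits′) below with <-cmp L L′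
... | tri< L<L′ _ _ = L<L′
... | tri≈ _ refl _ = ⊥-elim (<⇒≱ below (+-monoʳ-≤ (K * L) (+-cancelʳ-≤ (minA L) u′ u
                         (subst (u′ + minA L ≤_) (sym top) fits′))))
top-below-next-block {K} {suc M} {u} {L′} {u′} 2≤K top (admissible _ fits′) below | tri> _ _ (s≤s L′≤M) =
  ⊥-elim (<-asym below (lower-block-below 2≤K L′≤M (≤-trans (m≤m+n u′ _) fits′) top))

next-block-bound : ∀ {K L h L′ u′} → h + h ≤ 2 + L → L < L′ → Admissible L′ u′ → K * suc L + h ≤ K * L′ + u′
next-block-bound {K} h+h≤2+L L<L′ (admissible L′≤2u′ _) =
  +-mono-≤ (*-monoʳ-≤ K L<L′) (half-≤ (≤-trans h+h≤2+L (s≤s (≤-trans L<L′ L′≤2u′))))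

block-jump : ∀ K {L u h} → u < K + h → K * L + u < K * suc L + h
block-jump K {L} {u} {h} u<K+h = begin-strict
  K * L + u        <⟨ +-monoʳ-< (K * L) u<K+h ⟩
  K * L + (K + h)  ≡⟨ solve (K ∷ L ∷ h ∷ []) ⟩
  K * suc L + h    ∎
  where open ≤-Reasoning

shifted-admissible : ∀ {L c j e} → L ≡ c + j → L ≤ c + c → e + minA L ≤ j → Admissible L (e + c)
shifted-admissible {L} {c} {j} {e} L≡c+j L≤2c fits = admissible
  (≤-trans L≤2c (+-mono-≤ (m≤n+m c e) (m≤n+m c e)))
  (begin
    e + c + minA L    ≡⟨ cong (_+ minA L) (+-comm e c) ⟩
    c + e + minA L    ≡⟨ +-assoc c e (minA L) ⟩
    c + (e + minA L)  ≤⟨ +-monoʳ-≤ c fits ⟩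
    c + j             ≡⟨ L≡c+j ⟨
    L                 ∎)
  where open ≤-Reasoning

shifted-top : ∀ {L c j e} → L ≡ c + j → e + minA L ≡ j → e + c + minA L ≡ L
shifted-top {L} {c} {j} {e} L≡c+j top = begin
  e + c + minA L    ≡⟨ cong (_+ minA L) (+-comm e c) ⟩
  c + e + minA L    ≡⟨ +-assoc c e (minA L) ⟩
  c + (e + minA L)  ≡⟨ cong (c +_) top ⟩
  c + j             ≡⟨ L≡c+j ⟨
  L                 ∎
  where open ≡-Reasoning

2*j≡j+j : ∀ j → 2 * j ≡ j + j
2*j≡j+j j = cong (j +_) (+-identityʳ j)

[1+j]+[1+j]≡2+2*j : ∀ j → suc j + suc j ≡ 2 + 2 * j
[1+j]+[1+j]≡2+2*j j = cong suc (trans (+-suc j j) (cong suc (sym (2*j≡j+j j))))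

even-end-offset : ∀ {e j} → e + minA (2 * j) ≡ j → e ≡ j / 3 * 3
even-end-offset {e} {j} top = m+%n≡n⇒m≡[n/d]*d {n = j} {d = 3} (trans (cong (e +_) (sym (minA-even j))) top)

odd-end-offset : ∀ {e j} → e + minA (suc (2 * j)) ≡ j → 2 + e ≡ (2 + j) / 3 * 3
odd-end-offset {e} {j} top = m+%n≡n⇒m≡[n/d]*d {n = 2 + j} {d = 3} (cong (2 +_) (trans (cong (e +_) (sym (minA-odd j))) top))

-- The last two fields make block L+1 start no later than one past the top of block L, so
-- the blocks L ≥ 2K+2 together cover a final segment of ℕ.
record TailBlock (K L u : ℕ) : Set where
  constructor tailBlock
  field
    admissible′ : Admissible L u
    2+2K≤L      : 2 * suc K ≤ L
    roomy       : 2 * K + 2 * minA L ≤ suc L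

tail-block-end : ∀ {K L u} → 2 ≤ K → u + minA L ≡ L → 2 * suc K ≤ L → 2 * K + 2 * minA L ≤ suc L →
                 ∃[ u′ ] (TailBlock K (suc L) u′ × K * suc L + u′ ≡ suc (K * L + u))
tail-block-end {K} {L} {u} 2≤K top 2+2K≤L roomy =
  u′ , tailBlock (admissible 1+L≤2u′ fits′) (m≤n⇒m≤1+n 2+2K≤L) roomy′ , value≡
  where
  open ≤-Reasoning
  m u′ : ℕ
  m = minA L
  u′ = suc u ∸ K
  2K+m≤1+u : 2 * K + m ≤ suc u
  2K+m≤1+u = +-cancelʳ-≤ m _ _ (begin
    2 * K + m + m    ≡⟨ +-assoc (2 * K) m m ⟩
    2 * K + (m + m)  ≡⟨ cong (2 * K +_) (cong (m +_) (+-identityʳ m)) ⟨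
    2 * K + 2 * m    ≤⟨ roomy ⟩
    suc L            ≡⟨ cong suc top ⟨
    suc u + m        ∎)
  K+u′≡1+u : K + u′ ≡ suc u
  K+u′≡1+u = m+[n∸m]≡n (≤-trans (m≤m+n K _) (≤-trans (m≤m+n (2 * K) m) 2K+m≤1+u))
  K+m≤u′ : K + m ≤ u′
  K+m≤u′ = +-cancelˡ-≤ K _ _ (begin
    K + (K + m)      ≡⟨ +-assoc K K m ⟨
    K + K + m        ≡⟨ cong (λ t → K + t + m) (+-identityʳ K) ⟨
    2 * K + m        ≤⟨ 2K+m≤1+u ⟩
    suc u            ≡⟨ K+u′≡1+u ⟨
    K + u′           ∎)
  1+L≤2u′ : suc L ≤ u′ + u′
  1+L≤2u′ = begin
    suc L            ≡⟨ cong suc top ⟨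
    suc u + m        ≡⟨ cong (_+ m) K+u′≡1+u ⟨
    K + u′ + m       ≡⟨ +-assoc K u′ m ⟩
    K + (u′ + m)     ≡⟨ cong (K +_) (+-comm u′ m) ⟩
    K + (m + u′)     ≡⟨ +-assoc K m u′ ⟨
    K + m + u′       ≤⟨ +-monoˡ-≤ u′ K+m≤u′ ⟩
    u′ + u′          ∎
  fits′ : u′ + minA (suc L) ≤ suc L
  fits′ = begin
    u′ + minA (suc L)  ≤⟨ +-monoʳ-≤ u′ (≤-trans (minA≤2 (suc L)) 2≤K) ⟩
    u′ + K             ≡⟨ +-comm u′ K ⟩
    K + u′             ≡⟨ K+u′≡1+u ⟩
    suc u              ≤⟨ s≤s (≤-trans (m≤m+n u m) (≤-reflexive top)) ⟩
    suc L              ∎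
  roomy′ : 2 * K + 2 * minA (suc L) ≤ suc (suc L)
  roomy′ = begin
    2 * K + 2 * minA (suc L)  ≤⟨ +-monoʳ-≤ (2 * K) (*-monoʳ-≤ 2 (minA≤2 (suc L))) ⟩
    2 * K + 4                 ≡⟨ solve (K ∷ []) ⟩
    2 + 2 * suc K             ≤⟨ +-monoʳ-≤ 2 2+2K≤L ⟩
    suc (suc L)               ∎
  value≡ : K * suc L + u′ ≡ suc (K * L + u)
  value≡ = begin-equality
    K * suc L + u′     ≡⟨ cong (_+ u′) (*-suc K L) ⟩
    K + K * L + u′     ≡⟨ cong (_+ u′) (+-comm K (K * L)) ⟩
    K * L + K + u′     ≡⟨ +-assoc (K * L) K u′ ⟩
    K * L + (K + u′)   ≡⟨ cong (K * L +_) K+u′≡1+u ⟩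
    K * L + suc u      ≡⟨ +-suc (K * L) u ⟩
    suc (K * L + u)    ∎

tail-successor : ∀ {K L u} → 2 ≤ K → TailBlock K L u →
                 ∃[ L′ ] ∃[ u′ ] (TailBlock K L′ u′ × K * L′ + u′ ≡ suc (K * L + u))
tail-successor {K} {L} {u} 2≤K (tailBlock (admissible L≤2u fits) 2+2K≤L roomy) with suc u + minA L ≤? L
... | yes fits′ = L , suc u ,
  tailBlock (admissible (≤-trans L≤2u (+-mono-≤ (n≤1+n u) (n≤1+n u))) fits′) 2+2K≤L roomy , +-suc (K * L) u
... | no ¬fits′ = suc L , tail-block-end 2≤K (≤-antisym fits (≮⇒≥ ¬fits′)) 2+2K≤L roomy


module ThreeGenerated (k : ℕ) (1≤k : 1 ≤ k) where

  K : ℕ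
  K = 3 * k

  2≤K : 2 ≤ K
  2≤K = ≤-trans (n≤1+n 2) (*-monoʳ-≤ 3 1≤k)

  G : ℕ → Set
  G = ⟨ OneOf₃ (6 * k + 1) (9 * k + 2) (9 * k + 3) ⟩

  K*-+-≡₃ : ∀ X Y → K * X + Y ≡₃ Y
  K*-+-≡₃ X Y = trans (cong (_% 3) rearrange) (+-multiple-≡₃ Y (k * X))
    where
    rearrange : 3 * k * X + Y ≡ Y + k * X * 3
    rearrange = solve (k ∷ X ∷ Y ∷ [])

  ⟨⟩⇒admissible : ∀ {w} → G w → ∃[ L ] ∃[ u ] (Admissible L u × w ≡ K * L + u)
  ⟨⟩⇒admissible w∈ with x , y , z , refl ← ⟨OneOf₃⟩⇒combination w∈ =
    2 * x + 3 * y + 3 * z , x + 2 * y + 3 * z , admissible L≤2u fits , solve (k ∷ x ∷ y ∷ z ∷ [])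
    where
    open ≤-Reasoning
    L≤2u : 2 * x + 3 * y + 3 * z ≤ (x + 2 * y + 3 * z) + (x + 2 * y + 3 * z)
    L≤2u = begin
      2 * x + 3 * y + 3 * z                        ≤⟨ m≤m+n _ (y + 3 * z) ⟩
      2 * x + 3 * y + 3 * z + (y + 3 * z)          ≡⟨ solve (x ∷ y ∷ z ∷ []) ⟩
      (x + 2 * y + 3 * z) + (x + 2 * y + 3 * z)    ∎
    minA≡ : minA (2 * x + 3 * y + 3 * z) ≡ x % 3
    minA≡ = trans (cong (_% 3) rearrange) ([m+kn]%n≡m%n x (x + 2 * y + 2 * z) 3)
      where
      rearrange : 2 * (2 * x + 3 * y + 3 * z) ≡ x + (x + 2 * y + 2 * z) * 3
      rearrange = solve (x ∷ y ∷ z ∷ [])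
    fits : (x + 2 * y + 3 * z) + minA (2 * x + 3 * y + 3 * z) ≤ 2 * x + 3 * y + 3 * z
    fits = begin
      (x + 2 * y + 3 * z) + minA (2 * x + 3 * y + 3 * z)  ≡⟨ cong (x + 2 * y + 3 * z +_) minA≡ ⟩
      (x + 2 * y + 3 * z) + x % 3                        ≤⟨ +-monoʳ-≤ _ (≤-trans (m%n≤m x 3) (m≤m+n x y)) ⟩
      (x + 2 * y + 3 * z) + (x + y)                      ≡⟨ solve (x ∷ y ∷ z ∷ []) ⟩
      2 * x + 3 * y + 3 * z                              ∎

  combination-value : ∀ x y z → G (K * (2 * x + 3 * y + 3 * z) + (x + 2 * y + 3 * z))
  combination-value x y z = subst G rearrange (combination⇒⟨OneOf₃⟩ x y z)
    where
    rearrange : x * (6 * k + 1) + y * (9 * k + 2) + z * (9 * k + 3) ≡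
                3 * k * (2 * x + 3 * y + 3 * z) + (x + 2 * y + 3 * z)
    rearrange = solve (k ∷ x ∷ y ∷ z ∷ [])

  admissible⇒⟨⟩ : ∀ {L u} → Admissible L u → G (K * L + u)
  admissible⇒⟨⟩ adm with x , y , z , refl , refl ← decompose-admissible adm = combination-value x y z

  above-block-top : ∀ {L u h w} → u + minA L ≡ L → h + h ≤ 2 + L → G w → K * L + u < w → K * suc L + h ≤ w
  above-block-top {h = h} top h+h≤2+L w∈ below with L′ , u′ , adm , refl ← ⟨⟩⇒admissible w∈ =
    next-block-bound {K} {h = h} h+h≤2+L (top-below-next-block 2≤K top adm below) adm

  -- T is where block 2K+2 starts; blocks from there on overlap.
  T : ℕ
  T = K * (2 * suc K) + suc K

  minA-2+2K : minA (2 * suc K) ≡ 1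
  minA-2+2K = trans (cong (_% 3) rearrange) ([m+kn]%n≡m%n 1 (1 + 4 * k) 3)
    where
    rearrange : 2 * (2 * suc (3 * k)) ≡ 1 + (1 + 4 * k) * 3
    rearrange = solve (k ∷ [])

  first-tail-block : TailBlock K (2 * suc K) (suc K)
  first-tail-block = tailBlock (admissible 2+2K≤2+2K fits) ≤-refl roomy
    where
    2+2K≤2+2K : 2 * suc K ≤ suc K + suc K
    2+2K≤2+2K = ≤-reflexive (cong (suc K +_) (+-identityʳ (suc K)))
    fits : suc K + minA (2 * suc K) ≤ 2 * suc K
    fits = subst (λ m → suc K + m ≤ 2 * suc K) (sym minA-2+2K) (+-monoʳ-≤ (suc K) (s≤s z≤n))
    roomy : 2 * K + 2 * minA (2 * suc K) ≤ suc (2 * suc K)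
    roomy = subst (λ m → 2 * K + 2 * m ≤ suc (2 * suc K)) (sym minA-2+2K)
      (m≤n⇒m≤1+n (≤-reflexive (trans (sym (*-distribˡ-+ 2 K 1)) (cong (2 *_) (+-comm K 1)))))

  tail-blocks : ∀ r → ∃[ L ] ∃[ u ] (TailBlock K L u × K * L + u ≡ T + r)
  tail-blocks zero = _ , _ , first-tail-block , sym (+-identityʳ T)
  tail-blocks (suc r) with tail-blocks r
  ... | L , u , tb , Lu≡T+r with tail-successor 2≤K tb
  ...   | L′ , u′ , tb′ , L′u′≡1+Lu =
    L′ , u′ , tb′ , trans L′u′≡1+Lu (trans (cong suc Lu≡T+r) (sym (+-suc T r)))

  cofinite : ∀ {v} → T ≤ v → G v
  cofinite T≤v with m≤n⇒∃[o]m+o≡n T≤v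
  ... | r , refl with tail-blocks r
  ...   | L , u , tb , Lu≡T+r = subst G Lu≡T+r (admissible⇒⟨⟩ (TailBlock.admissible′ tb))

  -- even j e and odd j e are the elements with offset e from the bottom of the blocks
  -- L = 2j and L = 2j+1, whose least elements have u = j and u = j+1.
  data State : Set where
    origin   : State
    even odd : ℕ → ℕ → State
    tail     : ℕ → State

  value : State → ℕ
  value origin     = 0
  value (even j e) = K * (2 * j) + (e + j)
  value (odd j e)  = K * suc (2 * j) + (e + suc j)
  value (tail v)   = v

  Invariant : State → Set
  Invariant origin     = ⊤
  Invariant (even j e) = 1 ≤ j × j ≤ K × e + minA (2 * j) ≤ j
  Invariant (odd j e)  = 1 ≤ j × j ≤ K × e + minA (suc (2 * j)) ≤ j
  Invariant (tail v)   = T ≤ v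

  -- phase s is the index of s modulo 3 (phase-state): block 2j has ≡ 1 and block 2j+1
  -- has ≡ 2 elements (mod 3) by even-end-offset and odd-end-offset, so every block pair
  -- starts at an index ≡ 1.
  phase : State → ℕ
  phase origin     = 0
  phase (even j e) = 1 + e
  phase (odd j e)  = 2 + e
  phase (tail v)   = v

  next-pair : ℕ → State
  next-pair j with j <? K
  ... | yes _ = even (suc j) 0
  ... | no _  = tail T

  step : State → State
  step origin = even 1 0
  step (even j e) with suc e + minA (2 * j) ≤? j
  ... | yes _ = even j (suc e)
  ... | no _  = odd j 0
  step (odd j e) with suc e + minA (suc (2 * j)) ≤? j
  ... | yes _ = odd j (suc e)
  ... | no _  = next-pair j
  step (tail v) = tail (suc v)

  value-next-pair : ∀ {j} → j ≤ K → value (next-pair j) ≡ K * (2 * suc j) + suc j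
  value-next-pair {j} j≤K with j <? K
  ... | yes _ = refl
  ... | no j≮K with refl ← ≤-antisym j≤K (≮⇒≥ j≮K) = refl

  next-pair-invariant : ∀ {j} → 1 ≤ j → j ≤ K → Invariant (next-pair j)
  next-pair-invariant {j} 1≤j _ with j <? K
  ... | yes j<K = s≤s z≤n , j<K , ≤-trans (minA≤2 (2 * suc j)) (s≤s 1≤j)
  ... | no _    = ≤-refl

  phase-next-pair : ∀ j → phase (next-pair j) ≡₃ 1
  phase-next-pair j with j <? K
  ... | yes _ = refl
  ... | no _  = trans (K*-+-≡₃ (2 * suc K) (suc K)) (trans (cong (λ n → suc n % 3) (*-comm 3 k)) (+-multiple-≡₃ 1 k))

  minA-odd-K : minA (suc (2 * K)) ≡ 2
  minA-odd-K = trans (minA-odd K) (trans (cong (λ n → (2 + n) % 3) (*-comm 3 k)) (+-multiple-≡₃ 2 k))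

  odd-offset<K : ∀ {j e} → e + minA (suc (2 * j)) ≤ j → j ≤ K → e < K
  odd-offset<K {j} {e} fits j≤K with m≤n⇒m<n∨m≡n j≤K
  ... | inj₁ j<K  = ≤-trans (s≤s (≤-trans (m≤m+n e _) fits)) j<K
  ... | inj₂ refl = ≤-trans (≤-trans (≤-reflexive (+-comm 1 e)) (+-monoʳ-≤ e (s≤s z≤n)))
                            (subst (λ m → e + m ≤ K) minA-odd-K fits)

  step-invariant : ∀ s → Invariant s → Invariant (step s)
  step-invariant origin _ = s≤s z≤n , ≤-trans (s≤s z≤n) 2≤K , s≤s z≤n
  step-invariant (even j e) (1≤j , j≤K , _) with suc e + minA (2 * j) ≤? j
  ... | yes fits = 1≤j , j≤K , fits
  ... | no _     = 1≤j , j≤K , minA-odd≤ 1≤j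
  step-invariant (odd j e) (1≤j , j≤K , _) with suc e + minA (suc (2 * j)) ≤? j
  ... | yes fits = 1≤j , j≤K , fits
  ... | no _     = next-pair-invariant 1≤j j≤K
  step-invariant (tail v) T≤v = m≤n⇒m≤1+n T≤v

  value-∈ : ∀ s → Invariant s → G (value s)
  value-∈ origin _ = gen-zero
  value-∈ (even j e) (_ , _ , fits) = admissible⇒⟨⟩ (shifted-admissible (2*j≡j+j j) (≤-reflexive (2*j≡j+j j)) fits)
  value-∈ (odd j e) (_ , _ , fits) =
    admissible⇒⟨⟩ (shifted-admissible (cong suc (2*j≡j+j j))
                     (s≤s (≤-trans (≤-reflexive (2*j≡j+j j)) (+-monoʳ-≤ j (n≤1+n j)))) fits)
  value-∈ (tail v) T≤v = cofinite T≤v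

  value-< : ∀ s → Invariant s → value s < value (step s)
  value-< origin _ = m≤n+m 1 (K * 2)
  value-< (even j e) (_ , j≤K , fits) with suc e + minA (2 * j) ≤? j
  ... | yes _ = ≤-reflexive (sym (+-suc (K * (2 * j)) (e + j)))
  ... | no _  = block-jump K (+-mono-≤-< (≤-trans (m≤m+n e _) (≤-trans fits j≤K)) (n<1+n j))
  value-< (odd j e) (_ , j≤K , fits) with suc e + minA (suc (2 * j)) ≤? j
  ... | yes _ = ≤-reflexive (sym (+-suc (K * suc (2 * j)) (e + suc j)))
  ... | no _  = subst (value (odd j e) <_) (sym (value-next-pair j≤K))
                  (subst (λ L → value (odd j e) < K * L + suc j) (sym (*-suc 2 j))
                    (block-jump K (+-monoˡ-< (suc j) (odd-offset<K fits j≤K))))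
  value-< (tail v) _ = n<1+n v

  first-element : ∀ {w} → G w → 0 < w → K * 2 + 1 ≤ w
  first-element w∈ 0<w with ⟨⟩⇒admissible w∈
  ... | zero , u , admissible _ fits , refl = ⊥-elim (<⇒≱ 0<w (≤-trans (≤-reflexive (cong (_+ u) (*-zeroʳ K)))
                                                 (≤-trans (≤-reflexive (sym (+-identityʳ u))) fits)))
  ... | suc zero , u , admissible _ fits , refl with s≤s () ← ≤-trans (m≤n+m 2 u) fits
  ... | suc (suc L) , zero , admissible () _ , refl
  ... | suc (suc L) , suc u , _ , refl = +-mono-≤ (*-monoʳ-≤ K (s≤s (s≤s z≤n))) (s≤s z≤n)

  value-next : ∀ s → Invariant s → ∀ {w} → G w → value s < w → value (step s) ≤ w
  value-next origin _ w∈ below = first-element w∈ below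
  value-next (even j e) (_ , _ , fits) w∈ below with suc e + minA (2 * j) ≤? j
  ... | yes _ = ≤-trans (≤-reflexive (+-suc (K * (2 * j)) (e + j))) below
  ... | no ¬fits = above-block-top (shifted-top (2*j≡j+j j) (≤-antisym fits (≮⇒≥ ¬fits)))
                     (≤-reflexive ([1+j]+[1+j]≡2+2*j j)) w∈ below
  value-next (odd j e) (_ , j≤K , fits) w∈ below with suc e + minA (suc (2 * j)) ≤? j
  ... | yes _ = ≤-trans (≤-reflexive (+-suc (K * suc (2 * j)) (e + suc j))) below
  ... | no ¬fits = subst (_≤ _) (sym (trans (value-next-pair j≤K) (cong (λ L → K * L + suc j) (*-suc 2 j))))
                     (above-block-top (shifted-top (cong suc (2*j≡j+j j)) (≤-antisym fits (≮⇒≥ ¬fits)))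
                       (≤-trans (≤-reflexive ([1+j]+[1+j]≡2+2*j j)) (n≤1+n _)) w∈ below)
  value-next (tail v) _ _ below = below

  phase-step : ∀ s → Invariant s → phase (step s) ≡₃ 1 + phase s
  phase-step origin _ = refl
  phase-step (even j e) (_ , _ , fits) with suc e + minA (2 * j) ≤? j
  ... | yes _ = refl
  ... | no ¬fits = sym (trans (cong (λ n → (2 + n) % 3) (even-end-offset (≤-antisym fits (≮⇒≥ ¬fits))))
                              (+-multiple-≡₃ 2 (j / 3)))
  phase-step (odd j e) (_ , _ , fits) with suc e + minA (suc (2 * j)) ≤? j
  ... | yes _ = refl
  ... | no ¬fits = trans (phase-next-pair j)
                     (sym (trans (cong (λ n → (1 + n) % 3) (odd-end-offset (≤-antisym fits (≮⇒≥ ¬fits))))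
                                 (+-multiple-≡₃ 1 ((2 + j) / 3))))
  phase-step (tail v) _ = refl

  value-step : ∀ s → Invariant s → ¬ (phase s ≡₃ 0) → value (step s) ≡₃ 1 + value s
  value-step origin _ phase≢0 = ⊥-elim (phase≢0 refl)
  value-step (even j e) (_ , _ , fits) _ with suc e + minA (2 * j) ≤? j
  ... | yes _ = cong (_% 3) (+-suc (K * (2 * j)) (e + j))
  ... | no ¬fits = begin
    (K * suc (2 * j) + suc j) % 3  ≡⟨ K*-+-≡₃ (suc (2 * j)) (suc j) ⟩
    suc j % 3                      ≡⟨ +-multiple-≡₃ (suc j) (j / 3) ⟨
    (suc j + j / 3 * 3) % 3        ≡⟨ cong (λ n → suc n % 3) (trans (+-comm j _) (cong (_+ j) (sym e≡))) ⟩
    suc (e + j) % 3                ≡⟨ K*-+-≡₃ (2 * j) (suc (e + j)) ⟨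
    (K * (2 * j) + suc (e + j)) % 3 ≡⟨ cong (_% 3) (+-suc (K * (2 * j)) (e + j)) ⟩
    suc (K * (2 * j) + (e + j)) % 3 ∎
    where
    open ≡-Reasoning
    e≡ : e ≡ j / 3 * 3
    e≡ = even-end-offset (≤-antisym fits (≮⇒≥ ¬fits))
  value-step (odd j e) (_ , _ , fits) phase≢0 with suc e + minA (suc (2 * j)) ≤? j
  ... | yes _ = cong (_% 3) (+-suc (K * suc (2 * j)) (e + suc j))
  ... | no ¬fits = ⊥-elim (phase≢0 (trans (cong (_% 3) (odd-end-offset (≤-antisym fits (≮⇒≥ ¬fits))))
                                         (m*n%n≡0 ((2 + j) / 3) 3)))
  value-step (tail v) _ _ = refl

  state : ℕ → State
  state zero    = origin
  state (suc i) = step (state i)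

  g : ℕ → ℕ
  g i = value (state i)

  state-invariant : ∀ i → Invariant (state i)
  state-invariant zero    = tt
  state-invariant (suc i) = step-invariant (state i) (state-invariant i)

  phase-state : ∀ i → phase (state i) ≡₃ i
  phase-state zero    = refl
  phase-state (suc i) = trans (phase-step (state i) (state-invariant i)) (+-congˡ-≡₃ 1 {phase (state i)} {i} (phase-state i))

  g-suc : ∀ i → ¬ (i ≡₃ 0) → g (suc i) ≡₃ 1 + g i
  g-suc i i≢0 = value-step (state i) (state-invariant i) (λ phase≡0 → i≢0 (trans (sym (phase-state i)) phase≡0))

  triple-residues : ∀ t (r : Fin 3) → ∃! _≡_ (λ (j : Fin 3) → g (t * 3 + suc (toℕ j)) % 3 ≡ toℕ r)
  triple-residues t = consecutive-residues (λ j → g (t * 3 + suc (toℕ j))) (within 1 (λ ())) (within 2 (λ ()))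
    where
    within : ∀ m → ¬ (m ≡₃ 0) → g (t * 3 + suc m) ≡₃ 1 + g (t * 3 + m)
    within m m≢0 = subst (λ i → g i ≡₃ 1 + g (t * 3 + m)) (sym (+-suc (t * 3) m))
      (g-suc (t * 3 + m) (λ i≡0 → m≢0 (trans (sym (trans (cong (_% 3) (+-comm (t * 3) m)) (+-multiple-≡₃ m t))) i≡0)))

  -- The first steps only decide inequalities between numerals, so g 1, g 2, g 3 compute.
  g-1 : 6 * k + 1 ≡ g 1
  g-1 = 6 * k + 1 ≡ 3 * k * 2 + 1 ∋ solve (k ∷ [])

  g-2 : 9 * k + 2 ≡ g 2
  g-2 = 9 * k + 2 ≡ 3 * k * 3 + 2 ∋ solve (k ∷ [])

  g-3 : 9 * k + 3 ≡ g 3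
  g-3 = 9 * k + 3 ≡ 3 * k * 3 + 3 ∋ solve (k ∷ [])

  generators⊆FirstGens : ∀ {s} → OneOf₃ (6 * k + 1) (9 * k + 2) (9 * k + 3) s → FirstGens 3 g s
  generators⊆FirstGens (inj₁ refl)        = 1 , 0F , refl , g-1
  generators⊆FirstGens (inj₂ (inj₁ refl)) = 2 , 1F , refl , g-2
  generators⊆FirstGens (inj₂ (inj₂ refl)) = 3 , 2F , refl , g-3

  FirstGens⊆generators : ∀ {s} → FirstGens 3 g s → OneOf₃ (6 * k + 1) (9 * k + 2) (9 * k + 3) s
  FirstGens⊆generators (_ , 0F , refl , refl) = inj₁ (sym g-1)
  FirstGens⊆generators (_ , 1F , refl , refl) = inj₂ (inj₁ (sym g-2))
  FirstGens⊆generators (_ , 2F , refl , refl) = inj₂ (inj₂ (sym g-3))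

  isPermutationNS : IsPermutationNS 3 G
  isPermutationNS = record
    { numerical = record { has-zero = gen-zero ; closed = ⟨⟩-+ ; cofinite = T , λ _ → cofinite }
    ; g         = g
    ; enum      = record
      { strictly-increasing = λ i → value-< (state i) (state-invariant i)
      ; in-G                = λ i → value-∈ (state i) (state-invariant i)
      ; exhaustive          = λ _ → increasing-exhaustive g refl (λ i → value-< (state i) (state-invariant i))
                                      (λ i → value-next (state i) (state-invariant i))
      }
    ; generated = λ _ → ⟨⟩-mono generators⊆FirstGens , ⟨⟩-mono FirstGens⊆generators
    ; residues  = triple-residues
    }

lemma4p3 : (k : ℕ) → 1 ≤ k →
    IsPermutationNS 3 ⟨ (λ x → x ≡ 6 * k + 1 ⊎ x ≡ 9 * k + 2 ⊎ x ≡ 9 * k + 3) ⟩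
lemma4p3 = ThreeGenerated.isPermutationNS
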